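{- For every graph transformation system $\mathcal R$ and every plain rule $p=\langle L\hookleftarrow K\hookrightarrow R\rangle$ there is an application condition $\mathrm{app}(\mathcal R,p)$ over $L$ such that for every transformation $G\Rightarrow_p H'$ with match $g:L\hookrightarrow G$, we have $g\models\mathrm{app}(\mathcal R,p)$ if and only if there exists a graph $H$ with $G\Rightarrow_{\mathcal R}H$. Consequently, the rule $\langle p,\neg\mathrm{app}(\mathcal R,p)\rangle$ is applicable to a graph only if no rule from $\mathcal R$ is applicable to it.
   Context: Graphs are finite directed graphs with node and edge labels from a fixed alphabet $\Lambda$; morphisms preserve sources, targets and labels. Graph conditions over a graph $P$: $\mathrm{true}$; $\exists(a,c)$ with $a:P\hookrightarrow C$ injective and $c$ a condition over $C$; $\neg c$; $c\wedge c'$. An injective morphism $p:P\hookrightarrow G$ satisfies $\mathrm{true}$; satisfies $\exists(a,c)$ iff there is an injective $q:C\hookrightarrow G$ with $q\circ a=p$ and $q\models c$; Boolean connectives as usual. A rule $\langle p,ac\rangle$ consists of a plain rule $p=\langle L\hookleftarrow K\hookrightarrow R\rangle$ (injective morphisms) and an application condition $ac$ over $L$; a plain rule $p$ abbreviates $\langle p,\mathrm{true}\rangle$. A direct transformation $G\Rightarrow_{r}H$ at an injective match $g:L\hookrightarrow G$ with $g\models ac$ consists of two pushouts (double-pushout approach). A rule is applicable to $G$ if some direct transformation from $G$ via it exists. A graph transformation system is a finite set of rules; $G\Rightarrow_{\mathcal R}H$ means $G\Rightarrow_r H$ for some $r\in\mathcal R$. -}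

module Defs where

open import Data.Nat using (ℕ)
open import Data.Fin using (Fin)
open import Data.Product using (Σ; Σ-syntax; ∃; ∃-syntax; _×_; _,_)
open import Data.Unit using (⊤)
open import Data.List using (List)
open import Data.List.Membership.Propositional using (_∈_)
open import Relation.Nullary using (¬_)
open import Relation.Binary.PropositionalEquality using (_≡_)
open import Function.Definitions using (Injective)

record Graph (Λ : Set) : Set where
  field
    nV nE : ℕ
    src tgt : Fin nE → Fin nV
    lv : Fin nV → Λ
    le : Fin nE → Λ
open Graph public

record Mor {Λ : Set} (G H : Graph Λ) : Set where
  field
    fV : Fin (nV G) → Fin (nV H)
    fE : Fin (nE G) → Fin (nE H)
    src-pres : ∀ e → src H (fE e) ≡ fV (src G e)
    tgt-pres : ∀ e → tgt H (fE e) ≡ fV (tgt G e)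
    lv-pres  : ∀ v → lv H (fV v) ≡ lv G v
    le-pres  : ∀ e → le H (fE e) ≡ le G e
open Mor public

module _ {Λ : Set} where

  _∘ₘ_ : {A B C : Graph Λ} → Mor B C → Mor A B → Mor A C
  _∘ₘ_ {A} {B} {C} g f = record
    { fV = λ v → fV g (fV f v)
    ; fE = λ e → fE g (fE f e)
    ; src-pres = λ e → trans (src-pres g (fE f e)) (cong (fV g) (src-pres f e))
    ; tgt-pres = λ e → trans (tgt-pres g (fE f e)) (cong (fV g) (tgt-pres f e))
    ; lv-pres = λ v → trans (lv-pres g (fV f v)) (lv-pres f v)
    ; le-pres = λ e → trans (le-pres g (fE f e)) (le-pres f e)
    }
    where open import Relation.Binary.PropositionalEquality using (trans; cong)

  _≈ₘ_ : {A B : Graph Λ} → Mor A B → Mor A B → Set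
  f ≈ₘ g = (∀ v → fV f v ≡ fV g v) × (∀ e → fE f e ≡ fE g e)

  IsInjective : {A B : Graph Λ} → Mor A B → Set
  IsInjective f = Injective _≡_ _≡_ (fV f) × Injective _≡_ _≡_ (fE f)

record Inj {Λ : Set} (A B : Graph Λ) : Set where
  constructor inj
  field
    mor : Mor A B
    isInj : IsInjective mor
open Inj public

module _ {Λ : Set} where

  _∘ᵢ_ : {A B C : Graph Λ} → Inj B C → Inj A B → Mor A C
  g ∘ᵢ f = mor g ∘ₘ mor f

  IsPushout : {A B C D : Graph Λ} → Mor A B → Mor A C → Mor B D → Mor C D → Set
  IsPushout {A} {B} {C} {D} f g i j =
    ((i ∘ₘ f) ≈ₘ (j ∘ₘ g)) ×
    (∀ (X : Graph Λ) (i' : Mor B X) (j' : Mor C X) → (i' ∘ₘ f) ≈ₘ (j' ∘ₘ g) →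
      Σ[ u ∈ Mor D X ] (((u ∘ₘ i) ≈ₘ i') × ((u ∘ₘ j) ≈ₘ j') ×
        (∀ (u' : Mor D X) → (u' ∘ₘ i) ≈ₘ i' → (u' ∘ₘ j) ≈ₘ j' → u' ≈ₘ u)))

data Cond {Λ : Set} : Graph Λ → Set where
  true : ∀ {P} → Cond P
  exists : ∀ {P C} → Inj P C → Cond C → Cond P
  not : ∀ {P} → Cond P → Cond P
  and : ∀ {P} → Cond P → Cond P → Cond P

_⊨_ : {Λ : Set} {P G : Graph Λ} → Inj P G → Cond P → Set
p ⊨ true = ⊤
_⊨_ {G = G} p (exists {C = C} a c) =
  Σ[ q ∈ Inj C G ] (((q ∘ᵢ a) ≈ₘ mor p) × (q ⊨ c))
p ⊨ not c = ¬ (p ⊨ c)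
p ⊨ and c c' = (p ⊨ c) × (p ⊨ c')

record PlainRule (Λ : Set) : Set where
  constructor plain
  field
    L K R : Graph Λ
    l : Inj K L
    r : Inj K R
open PlainRule public

record Rule (Λ : Set) : Set where
  constructor ⟨_,_⟩
  field
    prule : PlainRule Λ
    ac : Cond (L prule)
open Rule public

asRule : {Λ : Set} → PlainRule Λ → Rule Λ
asRule p = ⟨ p , true ⟩

DirectTransf : {Λ : Set} (ρ : Rule Λ) (G H : Graph Λ) → Inj (L (prule ρ)) G → Set
DirectTransf {Λ} ρ G H g =
  (g ⊨ ac ρ) ×
  (Σ[ D ∈ Graph Λ ] Σ[ k ∈ Mor (K p) D ] Σ[ d ∈ Mor D G ]
   Σ[ h ∈ Mor D H ] Σ[ m ∈ Mor (R p) H ]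
     (IsPushout (mor (l p)) k (mor g) d × IsPushout (mor (r p)) k m h))
  where p = prule ρ

_⇒[_]_ : {Λ : Set} → Graph Λ → Rule Λ → Graph Λ → Set
G ⇒[ ρ ] H = Σ[ g ∈ Inj (L (prule ρ)) G ] DirectTransf ρ G H g

Applicable : {Λ : Set} → Rule Λ → Graph Λ → Set
Applicable ρ G = ∃[ H ] (G ⇒[ ρ ] H)

GTS : Set → Set
GTS Λ = List (Rule Λ)

_⇒ₛ[_]_ : {Λ : Set} → Graph Λ → GTS Λ → Graph Λ → Set
G ⇒ₛ[ ℛ ] H = Σ[ ρ ∈ _ ] ((ρ ∈ ℛ) × (G ⇒[ ρ ] H))

-- The application condition is the disjunction, over the rules ρ of ℛ, of "the left-hand
-- side of ρ occurs in G by a match satisfying ac ρ and the dangling condition".  Since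
-- matches are injective, a double pushout exists at a match exactly when the dangling
-- condition holds: a pushout is jointly surjective and only identifies items of the
-- interface (seen by mapping it to a graph of colours), and conversely the pushout
-- complement and pushout can be built explicitly.  The dangling condition is a graph
-- condition over the left-hand side (no extra edge at a deleted node), and a condition over
-- one graph is transported to any other by shifting along the empty graph, which enumerates
-- the finitely many gluings of the two graphs.  Satisfaction is decidable, all searches
-- being over finite sets of maps, which gives the disjunction its classical meaning.

module Submission where

open import Defs
open import Data.Nat using (ℕ; zero; suc; _+_; _*_)
open import Data.Fin using (Fin; zero; suc; _↑ˡ_; _↑ʳ_; splitAt; combine; remQuot)
open import Data.Fin.Properties
  using (_≟_; any?; all?; suc-injective; 0≢1+n; ↑ʳ-injective; splitAt-↑ˡ; splitAt-↑ʳ; join-splitAt;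
         remQuot-combine; combine-injectiveʳ)
open import Data.Vec.Functional using (head; tail) renaming (_∷_ to _∷ᶠ_)
open import Data.List using ([]; _∷_)
open import Data.List.Membership.Propositional using (_∈_)
open import Data.List.Relation.Unary.Any using (here; there)
open import Data.Product using (Σ; Σ-syntax; ∃; ∃₂; ∃-syntax; _×_; _,_; proj₁; proj₂; map₂)
open import Data.Sum using (_⊎_; inj₁; inj₂; [_,_]′)
open import Data.Unit using (tt)
open import Data.Empty using (⊥-elim)
open import Function using (_∘_)
open import Function.Definitions using (Injective)
open import Function.Bundles using (_⇔_; mk⇔; Equivalence)
open import Relation.Nullary using (¬_; Dec; yes; no)
open import Relation.Nullary.Decidable using (map′; _×-dec_; _⊎-dec_; _→-dec_; ¬?; decidable-stable)
open import Relation.Unary using (Decidable)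
open import Relation.Binary.PropositionalEquality
  using (_≡_; _≢_; _≗_; refl; sym; trans; cong; cong₂; subst; module ≡-Reasoning)

injective? : ∀ {n m} (f : Fin n → Fin m) → Dec (Injective _≡_ _≡_ f)
injective? f = map′ (λ h {x} {y} → h x y) (λ h x y → h)
  (all? λ x → all? λ y → (f x ≟ f y) →-dec (x ≟ y))

injective-resp : ∀ {n m} {f g : Fin n → Fin m} → f ≗ g → Injective _≡_ _≡_ f → Injective _≡_ _≡_ g
injective-resp f≗g f-inj {x} {y} gx≡gy = f-inj (trans (f≗g x) (trans gx≡gy (sym (f≗g y))))

any-fun? : ∀ n {m} {P : (Fin n → Fin m) → Set} →
  (∀ {f g} → f ≗ g → P f → P g) → Decidable P → Dec (∃ P)
any-fun? zero resp P? = map′ (_ ,_) (λ (f , p) → resp (λ ()) p) (P? (λ ()))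
any-fun? (suc n) resp P? =
  map′ (λ (x , f , p) → x ∷ᶠ f , p)
       (λ (f , p) → head f , tail f , resp (λ { zero → refl ; (suc i) → refl }) p)
       (any? λ x → any-fun? n (λ f≗g → resp λ { zero → refl ; (suc i) → f≗g i }) (λ f → P? (x ∷ᶠ f)))

record Enumeration {n : ℕ} (P : Fin n → Set) : Set where
  field
    size : ℕ
    embed : Fin size → Fin n
    embed-injective : Injective _≡_ _≡_ embed
    embed-∈ : ∀ i → P (embed i)
    index : ∀ x → P x → Fin size
    embed-index : ∀ x px → embed (index x px) ≡ x

  index-embed : ∀ i p → index (embed i) p ≡ i
  index-embed i p = embed-injective (embed-index (embed i) p)

  index-cong : ∀ {x y} px py → x ≡ y → index x px ≡ index y py
  index-cong {x} px py x≡y = embed-injective (trans (embed-index x px) (trans x≡y (sym (embed-index _ py))))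

enumerate : ∀ {n} {P : Fin n → Set} → Decidable P → Enumeration P
enumerate {zero} P? = record
  { size = 0 ; embed = λ () ; embed-injective = λ { {()} } ; embed-∈ = λ ()
  ; index = λ () ; embed-index = λ () }
enumerate {suc n} {P} P? with P? zero | enumerate (P? ∘ suc)
... | yes p0 | S = record
  { size = suc size ; embed = embed′ ; embed-injective = embed′-injective ; embed-∈ = embed′-∈
  ; index = index′ ; embed-index = embed-index′ }
  where
    open Enumeration S
    embed′ : Fin (suc size) → Fin (suc n)
    embed′ zero = zero
    embed′ (suc i) = suc (embed i)
    embed′-injective : Injective _≡_ _≡_ embed′
    embed′-injective {zero} {zero} _ = refl
    embed′-injective {suc i} {suc j} eq = cong suc (embed-injective (suc-injective eq))
    embed′-∈ : ∀ i → P (embed′ i)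
    embed′-∈ zero = p0
    embed′-∈ (suc i) = embed-∈ i
    index′ : ∀ x → P x → Fin (suc size)
    index′ zero _ = zero
    index′ (suc x) p = suc (index x p)
    embed-index′ : ∀ x px → embed′ (index′ x px) ≡ x
    embed-index′ zero _ = refl
    embed-index′ (suc x) p = cong suc (embed-index x p)
... | no ¬p0 | S = record
  { size = size ; embed = suc ∘ embed ; embed-injective = embed-injective ∘ suc-injective
  ; embed-∈ = embed-∈ ; index = index′ ; embed-index = embed-index′ }
  where
    open Enumeration S
    index′ : ∀ x → P x → Fin size
    index′ zero p = ⊥-elim (¬p0 p)
    index′ (suc x) p = index x p
    embed-index′ : ∀ x px → suc (embed (index′ x px)) ≡ x
    embed-index′ zero p = ⊥-elim (¬p0 p)
    embed-index′ (suc x) p = cong suc (embed-index x p)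

Image : ∀ {n m} → (Fin n → Fin m) → Fin m → Set
Image f y = ∃ λ x → f x ≡ y

image? : ∀ {n m} (f : Fin n → Fin m) → Decidable (Image f)
image? f y = any? λ x → f x ≟ y

IsFibreChoice : ∀ {n m} → (Fin n → Fin m) → (Fin n → Fin n) → Set
IsFibreChoice f κ = (∀ x → f (κ x) ≡ f x) × (∀ {x y} → f x ≡ f y → κ x ≡ κ y)

isFibreChoice-resp : ∀ {n m} {f : Fin n → Fin m} {κ κ′ : Fin n → Fin n} →
  κ ≗ κ′ → IsFibreChoice f κ → IsFibreChoice f κ′
isFibreChoice-resp {f = f} κ≗κ′ (sound , complete) =
  (λ x → trans (cong f (sym (κ≗κ′ x))) (sound x)) ,
  (λ {x} {y} fx≡fy → trans (sym (κ≗κ′ x)) (trans (complete fx≡fy) (κ≗κ′ y)))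

module Representative {n m : ℕ} (f : Fin n → Fin m) where

  private
    pick : ∀ {a} → Dec (Image f a) → Fin n → Fin n
    pick (yes (y , _)) _ = y
    pick (no _) d = d

    pick-preimage : ∀ {a} (a? : Dec (Image f a)) d → f d ≡ a → f (pick a? d) ≡ a
    pick-preimage (yes (_ , fy≡a)) _ _ = fy≡a
    pick-preimage (no _) _ fd≡a = fd≡a

    pick-irrelevant : ∀ {a} (a? : Dec (Image f a)) d d′ → f d ≡ a → pick a? d ≡ pick a? d′
    pick-irrelevant (yes _) _ _ _ = refl
    pick-irrelevant (no ¬p) d _ fd≡a = ⊥-elim (¬p (d , fd≡a))

  rep : Fin n → Fin n
  rep x = pick (image? f (f x)) x

  rep-isFibreChoice : IsFibreChoice f rep
  rep-isFibreChoice = (λ x → pick-preimage (image? f (f x)) x refl) , λ {x} {y} fx≡fy →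
    trans (cong (λ a → pick (image? f a) x) fx≡fy) (pick-irrelevant (image? f (f y)) x y fx≡fy)

[_,_]ᶠ : ∀ {a b} {X : Set} → (Fin a → X) → (Fin b → X) → Fin (a + b) → X
[_,_]ᶠ {a} f g i = [ f , g ]′ (splitAt a i)

[,]ᶠ-↑ˡ : ∀ {a b} {X : Set} (f : Fin a → X) (g : Fin b → X) i → [ f , g ]ᶠ (i ↑ˡ b) ≡ f i
[,]ᶠ-↑ˡ {a} {b} f g i rewrite splitAt-↑ˡ a i b = refl

[,]ᶠ-↑ʳ : ∀ {a b} {X : Set} (f : Fin a → X) (g : Fin b → X) j → [ f , g ]ᶠ (a ↑ʳ j) ≡ g j
[,]ᶠ-↑ʳ {a} {b} f g j rewrite splitAt-↑ʳ a b j = refl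

data SplitView (a b : ℕ) : Fin (a + b) → Set where
  left  : ∀ i → SplitView a b (i ↑ˡ b)
  right : ∀ j → SplitView a b (a ↑ʳ j)

splitView : ∀ a b (x : Fin (a + b)) → SplitView a b x
splitView a b x with splitAt a x | join-splitAt a b x
... | inj₁ i | eq = subst (SplitView a b) eq (left i)
... | inj₂ j | eq = subst (SplitView a b) eq (right j)

module _ {k : ℕ} where

  Gr : Set
  Gr = Graph (Fin k)

  _≈ₘ?_ : {A B : Gr} (f g : Mor A B) → Dec (f ≈ₘ g)
  f ≈ₘ? g = all? (λ v → fV f v ≟ fV g v) ×-dec all? (λ e → fE f e ≟ fE g e)

  _∘ⁱ_ : {A B C : Gr} → Inj B C → Inj A B → Inj A C
  g ∘ⁱ f = inj (g ∘ᵢ f) ((λ eq → proj₁ (isInj f) (proj₁ (isInj g) eq)) , (λ eq → proj₂ (isInj f) (proj₂ (isInj g) eq)))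

  IsMorphism : (C G : Gr) → (Fin (nV C) → Fin (nV G)) → (Fin (nE C) → Fin (nE G)) → Set
  IsMorphism C G fv fe =
    (∀ e → src G (fe e) ≡ fv (src C e)) × (∀ e → tgt G (fe e) ≡ fv (tgt C e)) ×
    (∀ v → lv G (fv v) ≡ lv C v) × (∀ e → le G (fe e) ≡ le C e)

  module _ {C G : Gr} where

    toMor : ∀ {fv fe} → IsMorphism C G fv fe → Mor C G
    toMor {fv} {fe} (s , t , l , l′) = record
      { fV = fv ; fE = fe ; src-pres = s ; tgt-pres = t ; lv-pres = l ; le-pres = l′ }

    isMorphism : (f : Mor C G) → IsMorphism C G (fV f) (fE f)
    isMorphism f = src-pres f , tgt-pres f , lv-pres f , le-pres f

    isMorphism? : ∀ fv fe → Dec (IsMorphism C G fv fe)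
    isMorphism? fv fe =
      all? (λ e → src G (fe e) ≟ fv (src C e)) ×-dec all? (λ e → tgt G (fe e) ≟ fv (tgt C e)) ×-dec
      all? (λ v → lv G (fv v) ≟ lv C v) ×-dec all? (λ e → le G (fe e) ≟ le C e)

    isMorphism-resp : ∀ {fv fe fv′ fe′} → fv ≗ fv′ → fe ≗ fe′ → IsMorphism C G fv fe → IsMorphism C G fv′ fe′
    isMorphism-resp eqV eqE (s , t , l , l′) =
      (λ e → trans (cong (src G) (sym (eqE e))) (trans (s e) (eqV _))) ,
      (λ e → trans (cong (tgt G) (sym (eqE e))) (trans (t e) (eqV _))) ,
      (λ v → trans (cong (lv G) (sym (eqV v))) (l v)) ,
      (λ e → trans (cong (le G) (sym (eqE e))) (l′ e))

    any-inj? : (P : Inj C G → Set) → (∀ {q q′} → mor q ≈ₘ mor q′ → P q → P q′) →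
      Decidable P → Dec (Σ (Inj C G) P)
    any-inj? P resp P? =
      map′ (λ (_ , _ , q , _ , _ , p) → q , p)
           (λ (q , p) → fV (mor q) , fE (mor q) , q , (λ _ → refl) , (λ _ → refl) , p)
           (any-fun? _ (λ eqV (fe , q , qV , qE , p) → fe , q , (λ v → trans (qV v) (eqV v)) , qE , p) λ fv →
            any-fun? _ (λ eqE (q , qV , qE , p) → q , qV , (λ e → trans (qE e) (eqE e)) , p) (realisation? fv))
      where
        Realisation : (Fin (nV C) → Fin (nV G)) → (Fin (nE C) → Fin (nE G)) → Set
        Realisation fv fe = Σ[ q ∈ Inj C G ] (fV (mor q) ≗ fv × fE (mor q) ≗ fe × P q)

        realisation? : ∀ fv fe → Dec (Realisation fv fe)
        realisation? fv fe with isMorphism? fv fe | injective? fv ×-dec injective? fe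
        ... | no ¬f | _ = no λ (q , qV , qE , _) → ¬f (isMorphism-resp qV qE (isMorphism (mor q)))
        ... | yes _ | no ¬i = no λ (q , qV , qE , _) →
              ¬i (injective-resp qV (proj₁ (isInj q)) , injective-resp qE (proj₂ (isInj q)))
        ... | yes f | yes i = map′ (λ p → q , (λ _ → refl) , (λ _ → refl) , p)
                                   (λ (q′ , qV , qE , p) → resp (qV , qE) p) (P? q)
          where q = inj (toMor f) i

  ⊨-resp : {P G : Gr} {p p′ : Inj P G} (c : Cond P) → mor p ≈ₘ mor p′ → p ⊨ c → p′ ⊨ c
  ⊨-resp true _ _ = tt
  ⊨-resp (exists a c) (eqV , eqE) (q , (cV , cE) , s) =
    q , ((λ v → trans (cV v) (eqV v)) , (λ e → trans (cE e) (eqE e))) , s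
  ⊨-resp (not c) (eqV , eqE) ¬s s = ¬s (⊨-resp c (sym ∘ eqV , sym ∘ eqE) s)
  ⊨-resp (and c d) p≈p′ (s , t) = ⊨-resp c p≈p′ s , ⊨-resp d p≈p′ t

  _⊨?_ : {P G : Gr} (p : Inj P G) (c : Cond P) → Dec (p ⊨ c)
  p ⊨? true = yes tt
  _⊨?_ {G = G} p (exists {C = C} a c) = any-inj? Witness resp λ q → ((q ∘ᵢ a) ≈ₘ? mor p) ×-dec (q ⊨? c)
    where
      Witness : Inj C G → Set
      Witness q = ((q ∘ᵢ a) ≈ₘ mor p) × (q ⊨ c)

      resp : ∀ {q q′} → mor q ≈ₘ mor q′ → Witness q → Witness q′
      resp (eqV , eqE) ((cV , cE) , s) =
        ((λ v → trans (sym (eqV _)) (cV v)) , (λ e → trans (sym (eqE _)) (cE e))) , ⊨-resp c (eqV , eqE) s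
  p ⊨? not c = ¬? (p ⊨? c)
  p ⊨? and c d = (p ⊨? c) ×-dec (p ⊨? d)

  false : {P : Gr} → Cond P
  false = not true

  or : {P : Gr} → Cond P → Cond P → Cond P
  or c d = not (and (not c) (not d))

  ⋁ : {P : Gr} (m : ℕ) → (Fin m → Cond P) → Cond P
  ⋁ zero F = false
  ⋁ (suc m) F = or (F zero) (⋁ m (F ∘ suc))

  ⋀ : {P : Gr} (m : ℕ) → (Fin m → Cond P) → Cond P
  ⋀ zero F = true
  ⋀ (suc m) F = and (F zero) (⋀ m (F ∘ suc))

  ⋁-fun : {P : Gr} (n m : ℕ) → ((Fin n → Fin m) → Cond P) → Cond P
  ⋁-fun zero m F = F (λ ())
  ⋁-fun (suc n) m F = ⋁ m λ x → ⋁-fun n m (F ∘ (x ∷ᶠ_))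

  given : {P : Gr} {X : Set} → Dec X → (X → Cond P) → Cond P
  given (yes x) F = F x
  given (no _) F = false

  module _ {P G : Gr} (g : Inj P G) where

    -- The classical reading of `or` rests on the decidability of satisfaction.
    ⊨-or : (c d : Cond P) → g ⊨ or c d ⇔ (g ⊨ c ⊎ g ⊨ d)
    ⊨-or c d = mk⇔ to λ { (inj₁ s) (¬s , _) → ¬s s ; (inj₂ t) (_ , ¬t) → ¬t t }
      where
        to : g ⊨ or c d → g ⊨ c ⊎ g ⊨ d
        to ¬¬cd with g ⊨? c | g ⊨? d
        ... | yes s | _ = inj₁ s
        ... | no _ | yes t = inj₂ t
        ... | no ¬s | no ¬t = ⊥-elim (¬¬cd (¬s , ¬t))

    ⊨-⋁ : ∀ m (F : Fin m → Cond P) → g ⊨ ⋁ m F ⇔ ∃ λ i → g ⊨ F i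
    ⊨-⋁ zero F = mk⇔ (λ s → ⊥-elim (s tt)) λ ()
    ⊨-⋁ (suc m) F = mk⇔ to from
      where
        to : g ⊨ ⋁ (suc m) F → ∃ λ i → g ⊨ F i
        to s with Equivalence.to (⊨-or _ _) s
        ... | inj₁ s₀ = zero , s₀
        ... | inj₂ s′ with Equivalence.to (⊨-⋁ m (F ∘ suc)) s′
        ...   | i , sᵢ = suc i , sᵢ
        from : (∃ λ i → g ⊨ F i) → g ⊨ ⋁ (suc m) F
        from (zero , s) = Equivalence.from (⊨-or _ _) (inj₁ s)
        from (suc i , s) = Equivalence.from (⊨-or _ _) (inj₂ (Equivalence.from (⊨-⋁ m (F ∘ suc)) (i , s)))

    ⊨-⋀ : ∀ m (F : Fin m → Cond P) → g ⊨ ⋀ m F ⇔ (∀ i → g ⊨ F i)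
    ⊨-⋀ zero F = mk⇔ (λ _ ()) (λ _ → tt)
    ⊨-⋀ (suc m) F = mk⇔
      (λ { (s , t) zero → s ; (s , t) (suc i) → Equivalence.to (⊨-⋀ m (F ∘ suc)) t i })
      (λ h → h zero , Equivalence.from (⊨-⋀ m (F ∘ suc)) (h ∘ suc))

    ⊨-⋁-fun⁺ : ∀ n m (F : (Fin n → Fin m) → Cond P) → g ⊨ ⋁-fun n m F → ∃ λ f → g ⊨ F f
    ⊨-⋁-fun⁺ zero m F s = _ , s
    ⊨-⋁-fun⁺ (suc n) m F s with Equivalence.to (⊨-⋁ m _) s
    ... | x , t with ⊨-⋁-fun⁺ n m _ t
    ...   | f , u = x ∷ᶠ f , u

    -- F need not respect ≗, hence the hypothesis for every f′ ≗ f.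
    ⊨-⋁-fun⁻ : ∀ n m (F : (Fin n → Fin m) → Cond P) (f : Fin n → Fin m) →
      (∀ f′ → f′ ≗ f → g ⊨ F f′) → g ⊨ ⋁-fun n m F
    ⊨-⋁-fun⁻ zero m F f h = h _ (λ ())
    ⊨-⋁-fun⁻ (suc n) m F f h = Equivalence.from (⊨-⋁ m _)
      (head f , ⊨-⋁-fun⁻ n m _ (tail f) λ f′ f′≗ → h _ λ { zero → refl ; (suc i) → f′≗ i })

    ⊨-given⁺ : {X : Set} (x? : Dec X) (F : X → Cond P) → g ⊨ given x? F → Σ X λ x → g ⊨ F x
    ⊨-given⁺ (yes x) F s = x , s
    ⊨-given⁺ (no _) F s = ⊥-elim (s tt)

    ⊨-given⁻ : {X : Set} (x? : Dec X) (F : X → Cond P) → (∀ x → g ⊨ F x) → X → g ⊨ given x? F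
    ⊨-given⁻ (yes x) F h _ = h x
    ⊨-given⁻ (no ¬x) F h x = ⊥-elim (¬x x)

  -- Coproducts and gluings

  module Coproduct (A B : Gr) where

    A⊕B : Gr
    A⊕B = record
      { nV = nV A + nV B ; nE = nE A + nE B
      ; src = [ (λ e → src A e ↑ˡ nV B) , (λ e → nV A ↑ʳ src B e) ]ᶠ
      ; tgt = [ (λ e → tgt A e ↑ˡ nV B) , (λ e → nV A ↑ʳ tgt B e) ]ᶠ
      ; lv = [ lv A , lv B ]ᶠ ; le = [ le A , le B ]ᶠ }

    ι₁ : Mor A A⊕B
    ι₁ = record
      { fV = _↑ˡ nV B ; fE = _↑ˡ nE B
      ; src-pres = [,]ᶠ-↑ˡ _ _ ; tgt-pres = [,]ᶠ-↑ˡ _ _ ; lv-pres = [,]ᶠ-↑ˡ _ _ ; le-pres = [,]ᶠ-↑ˡ _ _ }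

    ι₂ : Mor B A⊕B
    ι₂ = record
      { fV = nV A ↑ʳ_ ; fE = nE A ↑ʳ_
      ; src-pres = [,]ᶠ-↑ʳ {nE A} _ _ ; tgt-pres = [,]ᶠ-↑ʳ {nE A} _ _
      ; lv-pres = [,]ᶠ-↑ʳ {nV A} _ _ ; le-pres = [,]ᶠ-↑ʳ {nE A} _ _ }

    module _ {G : Gr} (f : Mor A G) (h : Mor B G) where

      [_,_]ₘ : Mor A⊕B G
      [_,_]ₘ = record
        { fV = [ fV f , fV h ]ᶠ ; fE = [ fE f , fE h ]ᶠ
        ; src-pres = src-pres′ ; tgt-pres = tgt-pres′ ; lv-pres = lv-pres′ ; le-pres = le-pres′ }
        where
          src-pres′ : ∀ e → src G ([ fE f , fE h ]ᶠ e) ≡ [ fV f , fV h ]ᶠ (src A⊕B e)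
          src-pres′ e with splitAt (nE A) e
          ... | inj₁ i rewrite splitAt-↑ˡ (nV A) (src A i) (nV B) = src-pres f i
          ... | inj₂ j rewrite splitAt-↑ʳ (nV A) (nV B) (src B j) = src-pres h j
          tgt-pres′ : ∀ e → tgt G ([ fE f , fE h ]ᶠ e) ≡ [ fV f , fV h ]ᶠ (tgt A⊕B e)
          tgt-pres′ e with splitAt (nE A) e
          ... | inj₁ i rewrite splitAt-↑ˡ (nV A) (tgt A i) (nV B) = tgt-pres f i
          ... | inj₂ j rewrite splitAt-↑ʳ (nV A) (nV B) (tgt B j) = tgt-pres h j
          lv-pres′ : ∀ v → lv G ([ fV f , fV h ]ᶠ v) ≡ lv A⊕B v
          lv-pres′ v with splitAt (nV A) v
          ... | inj₁ i = lv-pres f i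
          ... | inj₂ j = lv-pres h j
          le-pres′ : ∀ e → le G ([ fE f , fE h ]ᶠ e) ≡ le A⊕B e
          le-pres′ e with splitAt (nE A) e
          ... | inj₁ i = le-pres f i
          ... | inj₂ j = le-pres h j

      [,]ₘ-ι₁ : ([_,_]ₘ ∘ₘ ι₁) ≈ₘ f
      [,]ₘ-ι₁ = [,]ᶠ-↑ˡ _ _ , [,]ᶠ-↑ˡ _ _

      [,]ₘ-ι₂ : ([_,_]ₘ ∘ₘ ι₂) ≈ₘ h
      [,]ₘ-ι₂ = [,]ᶠ-↑ʳ {nV A} _ _ , [,]ᶠ-↑ʳ {nE A} _ _

    -- A gluing of A and B is encoded by idempotent maps κ on the nodes and edges of A ⊕ B,
    -- picking a representative of each class of identified items; the glued graph consists
    -- of the representatives.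
    record IsGluing (κV : Fin (nV A⊕B) → Fin (nV A⊕B)) (κE : Fin (nE A⊕B) → Fin (nE A⊕B)) : Set where
      field
        κV-idem : ∀ x → κV (κV x) ≡ κV x
        κE-idem : ∀ e → κE (κE e) ≡ κE e
        κ-src : ∀ e → κV (src A⊕B (κE e)) ≡ κV (src A⊕B e)
        κ-tgt : ∀ e → κV (tgt A⊕B (κE e)) ≡ κV (tgt A⊕B e)
        κ-lv : ∀ x → lv A⊕B (κV x) ≡ lv A⊕B x
        κ-le : ∀ e → le A⊕B (κE e) ≡ le A⊕B e
        κV∘ι₁-injective : Injective _≡_ _≡_ (κV ∘ fV ι₁)
        κE∘ι₁-injective : Injective _≡_ _≡_ (κE ∘ fE ι₁)
        κV∘ι₂-injective : Injective _≡_ _≡_ (κV ∘ fV ι₂)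
        κE∘ι₂-injective : Injective _≡_ _≡_ (κE ∘ fE ι₂)

    isGluing? : ∀ κV κE → Dec (IsGluing κV κE)
    isGluing? κV κE =
      let conditions? =
            all? (λ x → κV (κV x) ≟ κV x) ×-dec all? (λ e → κE (κE e) ≟ κE e) ×-dec
            all? (λ e → κV (src A⊕B (κE e)) ≟ κV (src A⊕B e)) ×-dec
            all? (λ e → κV (tgt A⊕B (κE e)) ≟ κV (tgt A⊕B e)) ×-dec
            all? (λ x → lv A⊕B (κV x) ≟ lv A⊕B x) ×-dec all? (λ e → le A⊕B (κE e) ≟ le A⊕B e) ×-dec
            injective? (κV ∘ fV ι₁) ×-dec injective? (κE ∘ fE ι₁) ×-dec
            injective? (κV ∘ fV ι₂) ×-dec injective? (κE ∘ fE ι₂)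
      in map′
        (λ (a , b , c , d , e , f , g , h , i , j) → record
          { κV-idem = a ; κE-idem = b ; κ-src = c ; κ-tgt = d ; κ-lv = e ; κ-le = f
          ; κV∘ι₁-injective = g ; κE∘ι₁-injective = h ; κV∘ι₂-injective = i ; κE∘ι₂-injective = j })
        (λ γ → let open IsGluing γ in
          κV-idem , κE-idem , κ-src , κ-tgt , κ-lv , κ-le ,
          (λ {_} {_} → κV∘ι₁-injective) , (λ {_} {_} → κE∘ι₁-injective) ,
          (λ {_} {_} → κV∘ι₂-injective) , (λ {_} {_} → κE∘ι₂-injective))
        conditions?

    module Glued {κV : Fin (nV A⊕B) → Fin (nV A⊕B)} {κE : Fin (nE A⊕B) → Fin (nE A⊕B)} (γ : IsGluing κV κE) where
      open IsGluing γ

      module NV = Enumeration (enumerate {P = λ x → κV x ≡ x} (λ x → κV x ≟ x))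
      module NE = Enumeration (enumerate {P = λ e → κE e ≡ e} (λ e → κE e ≟ e))

      glued : Gr
      glued = record
        { nV = NV.size ; nE = NE.size
        ; src = λ e → NV.index (κV (src A⊕B (NE.embed e))) (κV-idem _)
        ; tgt = λ e → NV.index (κV (tgt A⊕B (NE.embed e))) (κV-idem _)
        ; lv = lv A⊕B ∘ NV.embed ; le = le A⊕B ∘ NE.embed }

      π : Mor A⊕B glued
      π = record
        { fV = λ x → NV.index (κV x) (κV-idem x) ; fE = λ e → NE.index (κE e) (κE-idem e)
        ; src-pres = λ e → NV.index-cong _ _ (trans (cong (κV ∘ src A⊕B) (NE.embed-index _ _)) (κ-src e))
        ; tgt-pres = λ e → NV.index-cong _ _ (trans (cong (κV ∘ tgt A⊕B) (NE.embed-index _ _)) (κ-tgt e))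
        ; lv-pres = λ x → trans (cong (lv A⊕B) (NV.embed-index _ _)) (κ-lv x)
        ; le-pres = λ e → trans (cong (le A⊕B) (NE.embed-index _ _)) (κ-le e) }

      π-reflectsV : ∀ {x y} → fV π x ≡ fV π y → κV x ≡ κV y
      π-reflectsV {x} {y} eq = trans (sym (NV.embed-index _ (κV-idem x))) (trans (cong NV.embed eq) (NV.embed-index _ (κV-idem y)))

      π-reflectsE : ∀ {x y} → fE π x ≡ fE π y → κE x ≡ κE y
      π-reflectsE {x} {y} eq = trans (sym (NE.embed-index _ (κE-idem x))) (trans (cong NE.embed eq) (NE.embed-index _ (κE-idem y)))

      ι₁′ : Inj A glued
      ι₁′ = inj (π ∘ₘ ι₁) (κV∘ι₁-injective ∘ π-reflectsV , κE∘ι₁-injective ∘ π-reflectsE)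

      ι₂′ : Inj B glued
      ι₂′ = inj (π ∘ₘ ι₂) (κV∘ι₂-injective ∘ π-reflectsV , κE∘ι₂-injective ∘ π-reflectsE)

      module Factor {G : Gr} (F : Mor A⊕B G) (κV-fibres : IsFibreChoice (fV F) κV) (κE-fibres : IsFibreChoice (fE F) κE) where

        factor : Inj glued G
        factor = inj (record
          { fV = fV F ∘ NV.embed ; fE = fE F ∘ NE.embed
          ; src-pres = λ e → trans (src-pres F (NE.embed e)) (sym (trans (cong (fV F) (NV.embed-index _ _)) (proj₁ κV-fibres _)))
          ; tgt-pres = λ e → trans (tgt-pres F (NE.embed e)) (sym (trans (cong (fV F) (NV.embed-index _ _)) (proj₁ κV-fibres _)))
          ; lv-pres = lv-pres F ∘ NV.embed ; le-pres = le-pres F ∘ NE.embed })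
          ( (λ {i} {j} eq → NV.embed-injective (trans (sym (NV.embed-∈ i)) (trans (proj₂ κV-fibres eq) (NV.embed-∈ j))))
          , (λ {i} {j} eq → NE.embed-injective (trans (sym (NE.embed-∈ i)) (trans (proj₂ κE-fibres eq) (NE.embed-∈ j)))))

        factor-π : (mor factor ∘ₘ π) ≈ₘ F
        factor-π = (λ x → trans (cong (fV F) (NV.embed-index _ _)) (proj₁ κV-fibres x))
                 , (λ e → trans (cong (fE F) (NE.embed-index _ _)) (proj₁ κE-fibres e))

    fibreChoice-isGluing : {G : Gr} (F : Mor A⊕B G) {κV : Fin (nV A⊕B) → Fin (nV A⊕B)} {κE : Fin (nE A⊕B) → Fin (nE A⊕B)} →
      IsFibreChoice (fV F) κV → IsFibreChoice (fE F) κE →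
      IsInjective (F ∘ₘ ι₁) → IsInjective (F ∘ₘ ι₂) → IsGluing κV κE
    fibreChoice-isGluing {G} F {κV} {κE} (soundV , completeV) (soundE , completeE) (injV₁ , injE₁) (injV₂ , injE₂) = record
      { κV-idem = λ x → completeV (soundV x)
      ; κE-idem = λ e → completeE (soundE e)
      ; κ-src = λ e → completeV (trans (sym (src-pres F _)) (trans (cong (src G) (soundE e)) (src-pres F e)))
      ; κ-tgt = λ e → completeV (trans (sym (tgt-pres F _)) (trans (cong (tgt G) (soundE e)) (tgt-pres F e)))
      ; κ-lv = λ x → trans (sym (lv-pres F _)) (trans (cong (lv G) (soundV x)) (lv-pres F x))
      ; κ-le = λ e → trans (sym (le-pres F _)) (trans (cong (le G) (soundE e)) (le-pres F e))
      ; κV∘ι₁-injective = injV₁ ∘ reflectV ; κE∘ι₁-injective = injE₁ ∘ reflectE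
      ; κV∘ι₂-injective = injV₂ ∘ reflectV ; κE∘ι₂-injective = injE₂ ∘ reflectE }
      where
        reflectV : ∀ {x y} → κV x ≡ κV y → fV F x ≡ fV F y
        reflectV {x} {y} eq = trans (sym (soundV x)) (trans (cong (fV F) eq) (soundV y))
        reflectE : ∀ {x y} → κE x ≡ κE y → fE F x ≡ fE F y
        reflectE {x} {y} eq = trans (sym (soundE x)) (trans (cong (fE F) eq) (soundE y))

    module JointImage {G : Gr} (q : Inj A G) (q′ : Inj B G) where

      F : Mor A⊕B G
      F = [ mor q , mor q′ ]ₘ

      F∘ι₁ : (F ∘ₘ ι₁) ≈ₘ mor q
      F∘ι₁ = [,]ₘ-ι₁ (mor q) (mor q′)

      F∘ι₂ : (F ∘ₘ ι₂) ≈ₘ mor q′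
      F∘ι₂ = [,]ₘ-ι₂ (mor q) (mor q′)

      module _ {κV : Fin (nV A⊕B) → Fin (nV A⊕B)} {κE : Fin (nE A⊕B) → Fin (nE A⊕B)}
               (fibresV : IsFibreChoice (fV F) κV) (fibresE : IsFibreChoice (fE F) κE) where

        fibres-isGluing : IsGluing κV κE
        fibres-isGluing = fibreChoice-isGluing F fibresV fibresE
          ( injective-resp (sym ∘ proj₁ F∘ι₁) (proj₁ (isInj q))
          , injective-resp (sym ∘ proj₂ F∘ι₁) (proj₂ (isInj q)))
          ( injective-resp (sym ∘ proj₁ F∘ι₂) (proj₁ (isInj q′))
          , injective-resp (sym ∘ proj₂ F∘ι₂) (proj₂ (isInj q′)))

        module _ (γ : IsGluing κV κE) where
          open Glued γ
          open Factor F fibresV fibresE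

          factor∘ι₁′ : (mor factor ∘ₘ mor ι₁′) ≈ₘ mor q
          factor∘ι₁′ = (λ x → trans (proj₁ factor-π _) (proj₁ F∘ι₁ x))
                     , (λ e → trans (proj₂ factor-π _) (proj₂ F∘ι₁ e))

          factor∘ι₂′ : (mor factor ∘ₘ mor ι₂′) ≈ₘ mor q′
          factor∘ι₂′ = (λ x → trans (proj₁ factor-π _) (proj₁ F∘ι₂ x))
                     , (λ e → trans (proj₂ factor-π _) (proj₂ F∘ι₂ e))

    Identifies : {X : Gr} → (Fin (nV A⊕B) → Fin (nV A⊕B)) → (Fin (nE A⊕B) → Fin (nE A⊕B)) →
      Mor X A⊕B → Mor X A⊕B → Set
    Identifies κV κE f g = (κV ∘ fV f ≗ κV ∘ fV g) × (κE ∘ fE f ≗ κE ∘ fE g)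

    identifies? : {X : Gr} → ∀ κV κE (f g : Mor X A⊕B) → Dec (Identifies κV κE f g)
    identifies? κV κE f g = all? (λ v → κV (fV f v) ≟ κV (fV g v)) ×-dec all? (λ e → κE (fE f e) ≟ κE (fE g e))

    GluingAlong : {X : Gr} → Mor X A⊕B → Mor X A⊕B →
      (Fin (nV A⊕B) → Fin (nV A⊕B)) → (Fin (nE A⊕B) → Fin (nE A⊕B)) → Set
    GluingAlong f g κV κE = IsGluing κV κE × Identifies κV κE f g

    -- Opaque: unfolding it inside shift makes checking ⊨-shift very expensive.
    opaque
      gluingAlong? : {X : Gr} (f g : Mor X A⊕B) → ∀ κV κE → Dec (GluingAlong f g κV κE)
      gluingAlong? f g κV κE = isGluing? κV κE ×-dec identifies? κV κE f g

  -- Shifting a condition along an injective morphism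

  -- An embedding C ↪ G extending q ∘ b overlaps the image of q : P ↪ G in a gluing of P and C
  -- that identifies the two images of B; shift enumerates these gluings.
  shift : {B P : Gr} → Inj B P → Cond B → Cond P
  shift b true = true
  shift {P = P} b (exists {C = C} a c) =
    ⋁-fun _ _ λ κV → ⋁-fun _ _ λ κE →
      given (gluingAlong? (ι₁ ∘ₘ mor b) (ι₂ ∘ₘ mor a) κV κE) λ γ →
        exists (Glued.ι₁′ (proj₁ γ)) (shift (Glued.ι₂′ (proj₁ γ)) c)
    where open Coproduct P C
  shift b (not c) = not (shift b c)
  shift b (and c d) = and (shift b c) (shift b d)

  ⊨-shift : {B P G : Gr} (b : Inj B P) (c : Cond B) (q : Inj P G) → q ⊨ shift b c ⇔ (q ∘ⁱ b) ⊨ c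
  ⊨-shift b true q = mk⇔ (λ _ → tt) (λ _ → tt)
  ⊨-shift b (not c) q = mk⇔
    (λ ¬s s → ¬s (Equivalence.from (⊨-shift b c q) s))
    (λ ¬s s → ¬s (Equivalence.to (⊨-shift b c q) s))
  ⊨-shift b (and c d) q = mk⇔
    (λ (s , t) → Equivalence.to (⊨-shift b c q) s , Equivalence.to (⊨-shift b d q) t)
    (λ (s , t) → Equivalence.from (⊨-shift b c q) s , Equivalence.from (⊨-shift b d q) t)
  ⊨-shift {P = P} {G} b (exists {C = C} a c) q = mk⇔ to from
    where
      open Coproduct P C

      gluing? : ∀ κV κE → Dec (GluingAlong (ι₁ ∘ₘ mor b) (ι₂ ∘ₘ mor a) κV κE)
      gluing? = gluingAlong? (ι₁ ∘ₘ mor b) (ι₂ ∘ₘ mor a)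

      glued : ∀ {κV κE} → GluingAlong (ι₁ ∘ₘ mor b) (ι₂ ∘ₘ mor a) κV κE → Cond P
      glued γ = exists (Glued.ι₁′ (proj₁ γ)) (shift (Glued.ι₂′ (proj₁ γ)) c)

      to : q ⊨ shift b (exists a c) → (q ∘ⁱ b) ⊨ exists a c
      to s with ⊨-⋁-fun⁺ q _ _ _ s
      ... | κV , s₁ with ⊨-⋁-fun⁺ q _ _ _ s₁
      ... | κE , s₂ with ⊨-given⁺ q (gluing? κV κE) glued s₂
      ... | (γ , identV , identE) , r , (rV , rE) , sr =
        r ∘ⁱ ι₂′ , (comV , comE) , Equivalence.to (⊨-shift ι₂′ c r) sr
        where
          open Glued γ
          comV : ∀ v → fV (mor r) (fV π (fV ι₂ (fV (mor a) v))) ≡ fV (mor q) (fV (mor b) v)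
          comV v = trans (cong (fV (mor r)) (NV.index-cong _ _ (sym (identV v)))) (rV _)
          comE : ∀ e → fE (mor r) (fE π (fE ι₂ (fE (mor a) e))) ≡ fE (mor q) (fE (mor b) e)
          comE e = trans (cong (fE (mor r)) (NE.index-cong _ _ (sym (identE e)))) (rE _)

      from : (q ∘ⁱ b) ⊨ exists a c → q ⊨ shift b (exists a c)
      from (q′ , (q′aV , q′aE) , s′) =
        ⊨-⋁-fun⁻ q _ _ _ κV λ κV′ κV′≗ → ⊨-⋁-fun⁻ q _ _ _ κE λ κE′ κE′≗ →
          glue (isFibreChoice-resp (sym ∘ κV′≗) κV-fibres) (isFibreChoice-resp (sym ∘ κE′≗) κE-fibres)
        where
          open JointImage q q′
          open Representative (fV F) using () renaming (rep to κV; rep-isFibreChoice to κV-fibres)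
          open Representative (fE F) using () renaming (rep to κE; rep-isFibreChoice to κE-fibres)

          glue : ∀ {κV′ κE′} → IsFibreChoice (fV F) κV′ → IsFibreChoice (fE F) κE′ →
            q ⊨ given (gluing? κV′ κE′) glued
          glue {κV′} {κE′} fibresV fibresE =
            ⊨-given⁻ q (gluing? κV′ κE′) glued witness (fibres-isGluing fibresV fibresE , identV , identE)
            where
              identV : ∀ v → κV′ (fV (mor b) v ↑ˡ nV C) ≡ κV′ (nV P ↑ʳ fV (mor a) v)
              identV v = proj₂ fibresV (trans (proj₁ F∘ι₁ _) (trans (sym (q′aV v)) (sym (proj₁ F∘ι₂ _))))
              identE : ∀ e → κE′ (fE (mor b) e ↑ˡ nE C) ≡ κE′ (nE P ↑ʳ fE (mor a) e)
              identE e = proj₂ fibresE (trans (proj₂ F∘ι₁ _) (trans (sym (q′aE e)) (sym (proj₂ F∘ι₂ _))))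
              witness : ∀ γ′ → q ⊨ glued γ′
              witness (γ′ , _) =
                factor , factor∘ι₁′ fibresV fibresE γ′ ,
                Equivalence.from (⊨-shift ι₂′ c factor) (⊨-resp c (sym ∘ proj₁ ≈q′ , sym ∘ proj₂ ≈q′) s′)
                where
                  open Glued γ′
                  open Factor F fibresV fibresE
                  ≈q′ : (mor factor ∘ₘ mor ι₂′) ≈ₘ mor q′
                  ≈q′ = factor∘ι₂′ fibresV fibresE γ′

  ∅ : Gr
  ∅ = record { nV = 0 ; nE = 0 ; src = λ () ; tgt = λ () ; lv = λ () ; le = λ () }

  ∅↪ : (X : Gr) → Inj ∅ X
  ∅↪ X = inj (record
    { fV = λ () ; fE = λ () ; src-pres = λ () ; tgt-pres = λ () ; lv-pres = λ () ; le-pres = λ () })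
    ((λ { {()} }) , (λ { {()} }))

  occurs : {P : Gr} (B : Gr) → Cond B → Cond P
  occurs {P} B c = shift (∅↪ P) (exists (∅↪ B) c)

  ⊨-occurs : {P G : Gr} (B : Gr) (c : Cond B) (g : Inj P G) → g ⊨ occurs B c ⇔ Σ (Inj B G) (_⊨ c)
  ⊨-occurs {P} B c g = mk⇔
    (λ s → let (m , _ , t) = Equivalence.to (⊨-shift (∅↪ P) (exists (∅↪ B) c) g) s in m , t)
    (λ (m , t) → Equivalence.from (⊨-shift (∅↪ P) (exists (∅↪ B) c) g) (m , ((λ ()) , (λ ())) , t))

  -- The dangling condition

  Dangling : {K L G : Gr} → Inj K L → Inj L G → Set
  Dangling {G = G} l m = ∀ e → ¬ Image (fE (mor m)) e → ∀ x → ¬ Image (fV (mor l)) x →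
    src G e ≢ fV (mor m) x × tgt G e ≢ fV (mor m) x

  -- L extended by j fresh nodes, numbered first, and one fresh edge from s to t.
  extend : (L : Gr) (j : ℕ) → (Fin j → Fin k) → (s t : Fin (j + nV L)) → Fin k → Gr
  extend L j labs s t a = record
    { nV = j + nV L ; nE = suc (nE L)
    ; src = s ∷ᶠ ((j ↑ʳ_) ∘ src L) ; tgt = t ∷ᶠ ((j ↑ʳ_) ∘ tgt L)
    ; lv = [ labs , lv L ]ᶠ ; le = a ∷ᶠ le L }

  extend↪ : (L : Gr) (j : ℕ) (labs : Fin j → Fin k) (s t : Fin (j + nV L)) (a : Fin k) → Inj L (extend L j labs s t a)
  extend↪ L j labs s t a = inj
    (record { fV = j ↑ʳ_ ; fE = suc ; src-pres = λ _ → refl ; tgt-pres = λ _ → refl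
            ; lv-pres = [,]ᶠ-↑ʳ {j} labs (lv L) ; le-pres = λ _ → refl })
    (↑ʳ-injective j _ _ , suc-injective)

  noLabels : Fin 0 → Fin k
  noLabels ()

  noEdge : (L : Gr) (j : ℕ) → (Fin j → Fin k) → (s t : Fin (j + nV L)) → Fin k → Cond L
  noEdge L j labs s t a = not (exists (extend↪ L j labs s t a) true)

  -- Since matches are injective, an edge of G outside the match and attached to node x of L
  -- either joins x to a node of L (no fresh node) or to a node outside the match (one fresh node).
  danglingAt : (L : Gr) → Fin (nV L) → Fin k → Cond L
  danglingAt L x a =
    and (⋀ (nV L) λ y → and (noEdge L 0 noLabels x y a) (noEdge L 0 noLabels y x a))
        (⋀ k λ μ → and (noEdge L 1 (λ _ → μ) (suc x) zero a) (noEdge L 1 (λ _ → μ) zero (suc x) a))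

  module Deleted {K L : Gr} (l : Inj K L) = Enumeration (enumerate (λ x → ¬? (image? (fV (mor l)) x)))

  danglingCond : {K L : Gr} → Inj K L → Cond L
  danglingCond {L = L} l = ⋀ size λ i → ⋀ k λ a → danglingAt L (embed i) a
    where open Deleted l

  module _ {L G : Gr} (m : Inj L G) where

    ⊨-extension : ∀ {j} (labs : Fin j → Fin k) (w : Fin j → Fin (nV G)) → lv G ∘ w ≗ labs →
      Injective _≡_ _≡_ w → (∀ i v → w i ≢ fV (mor m) v) →
      (e : Fin (nE G)) → ¬ Image (fE (mor m)) e → (s t : Fin (j + nV L)) →
      src G e ≡ [ w , fV (mor m) ]ᶠ s → tgt G e ≡ [ w , fV (mor m) ]ᶠ t →
      m ⊨ exists (extend↪ L j labs s t (le G e)) true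
    ⊨-extension {j} labs w w-labs w-inj w∉m e e∉m s t src-e tgt-e =
      inj (record { fV = qV ; fE = qE ; src-pres = src-pres′ ; tgt-pres = tgt-pres′ ; lv-pres = lv-pres′ ; le-pres = le-pres′ })
          (qV-injective , qE-injective) ,
      ([,]ᶠ-↑ʳ {j} w (fV (mor m)) , (λ _ → refl)) , tt
      where
        qV : Fin (j + nV L) → Fin (nV G)
        qV = [ w , fV (mor m) ]ᶠ
        qE : Fin (suc (nE L)) → Fin (nE G)
        qE = e ∷ᶠ fE (mor m)

        src-pres′ : ∀ a → src G (qE a) ≡ qV (src (extend L j labs s t (le G e)) a)
        src-pres′ zero = src-e
        src-pres′ (suc a) = trans (src-pres (mor m) a) (sym ([,]ᶠ-↑ʳ {j} w (fV (mor m)) _))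
        tgt-pres′ : ∀ a → tgt G (qE a) ≡ qV (tgt (extend L j labs s t (le G e)) a)
        tgt-pres′ zero = tgt-e
        tgt-pres′ (suc a) = trans (tgt-pres (mor m) a) (sym ([,]ᶠ-↑ʳ {j} w (fV (mor m)) _))
        lv-pres′ : ∀ v → lv G (qV v) ≡ [ labs , lv L ]ᶠ v
        lv-pres′ v with splitAt j v
        ... | inj₁ i = w-labs i
        ... | inj₂ u = lv-pres (mor m) u
        le-pres′ : ∀ a → le G (qE a) ≡ (le G e ∷ᶠ le L) a
        le-pres′ zero = refl
        le-pres′ (suc a) = le-pres (mor m) a

        qV-injective : Injective _≡_ _≡_ qV
        qV-injective {a} {b} eq with splitView j (nV L) a | splitView j (nV L) b
        ... | left i | left i′ = cong (_↑ˡ nV L) (w-inj (trans (sym ([,]ᶠ-↑ˡ w _ i)) (trans eq ([,]ᶠ-↑ˡ w _ i′))))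
        ... | left i | right v = ⊥-elim (w∉m i v (trans (sym ([,]ᶠ-↑ˡ w _ i)) (trans eq ([,]ᶠ-↑ʳ {j} w _ v))))
        ... | right v | left i = ⊥-elim (w∉m i v (trans (sym ([,]ᶠ-↑ˡ w _ i)) (trans (sym eq) ([,]ᶠ-↑ʳ {j} w _ v))))
        ... | right v | right v′ =
          cong (j ↑ʳ_) (proj₁ (isInj m) (trans (sym ([,]ᶠ-↑ʳ {j} w _ v)) (trans eq ([,]ᶠ-↑ʳ {j} w _ v′))))
        qE-injective : Injective _≡_ _≡_ qE
        qE-injective {zero} {zero} _ = refl
        qE-injective {zero} {suc b} eq = ⊥-elim (e∉m (b , sym eq))
        qE-injective {suc a} {zero} eq = ⊥-elim (e∉m (a , eq))
        qE-injective {suc a} {suc b} eq = cong suc (proj₂ (isInj m) eq)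

    extension-edge∉ : ∀ {j labs s t a} (w : m ⊨ exists (extend↪ L j labs s t a) true) →
      ¬ Image (fE (mor m)) (fE (mor (proj₁ w)) zero)
    extension-edge∉ (q , (_ , qE) , _) (e′ , eq) = 0≢1+n (proj₂ (isInj q) (trans (sym eq) (sym (qE e′))))

  module _ {K L G : Gr} (l : Inj K L) (m : Inj L G) where

    dangling⇒⊨noEdge : Dangling l m → ∀ {x} → ¬ Image (fV (mor l)) x →
      ∀ j labs s t a → s ≡ j ↑ʳ x ⊎ t ≡ j ↑ʳ x → m ⊨ noEdge L j labs s t a
    dangling⇒⊨noEdge dangling {x} x∉l j labs s t a at-x w@(q , (qV , _) , _) with at-x
    ... | inj₁ refl = proj₁ (dangling _ (extension-edge∉ m w) x x∉l) (trans (src-pres (mor q) zero) (qV x))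
    ... | inj₂ refl = proj₂ (dangling _ (extension-edge∉ m w) x x∉l) (trans (tgt-pres (mor q) zero) (qV x))

    dangling⇒⊨danglingCond : Dangling l m → m ⊨ danglingCond l
    dangling⇒⊨danglingCond dangling =
      Equivalence.from (⊨-⋀ m _ _) λ i → Equivalence.from (⊨-⋀ m _ _) λ a →
        let x∉l = embed-∈ i ; noEdge-at-x = dangling⇒⊨noEdge dangling x∉l in
        Equivalence.from (⊨-⋀ m _ _) (λ y →
          noEdge-at-x 0 noLabels (embed i) y a (inj₁ refl) , noEdge-at-x 0 noLabels y (embed i) a (inj₂ refl)) ,
        Equivalence.from (⊨-⋀ m _ _) (λ μ →
          noEdge-at-x 1 (λ _ → μ) (suc (embed i)) zero a (inj₁ refl) , noEdge-at-x 1 (λ _ → μ) zero (suc (embed i)) a (inj₂ refl))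
      where open Deleted l

    ⊨danglingCond⇒dangling : m ⊨ danglingCond l → Dangling l m
    ⊨danglingCond⇒dangling s e e∉m x x∉l = src≢ , tgt≢
      where
        open Deleted l
        at-x : m ⊨ danglingAt L x (le G e)
        at-x = subst (λ x → m ⊨ danglingAt L x (le G e)) (embed-index x x∉l)
          (Equivalence.to (⊨-⋀ m _ _) (Equivalence.to (⊨-⋀ m _ _) s (index x x∉l)) (le G e))
        old : ∀ y → m ⊨ and (noEdge L 0 noLabels x y (le G e)) (noEdge L 0 noLabels y x (le G e))
        old = Equivalence.to (⊨-⋀ m _ _) (proj₁ at-x)
        fresh : ∀ μ → m ⊨ and (noEdge L 1 (λ _ → μ) (suc x) zero (le G e)) (noEdge L 1 (λ _ → μ) zero (suc x) (le G e))
        fresh = Equivalence.to (⊨-⋀ m _ _) (proj₂ at-x)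

        ⊨-old : ∀ s t → src G e ≡ fV (mor m) s → tgt G e ≡ fV (mor m) t →
          m ⊨ exists (extend↪ L 0 noLabels s t (le G e)) true
        ⊨-old = ⊨-extension m noLabels (λ ()) (λ ()) (λ { {()} }) (λ ()) e e∉m
        ⊨-fresh : ∀ o → ¬ Image (fV (mor m)) o → ∀ s t →
          src G e ≡ [ (λ _ → o) , fV (mor m) ]ᶠ s → tgt G e ≡ [ (λ _ → o) , fV (mor m) ]ᶠ t →
          m ⊨ exists (extend↪ L 1 (λ _ → lv G o) s t (le G e)) true
        ⊨-fresh o o∉m = ⊨-extension m (λ _ → lv G o) (λ _ → o) (λ _ → refl) (λ { {zero} {zero} _ → refl })
          (λ _ v eq → o∉m (v , sym eq)) e e∉m

        src≢ : src G e ≢ fV (mor m) x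
        src≢ src-e with image? (fV (mor m)) (tgt G e)
        ... | yes (y , my) = proj₁ (old y) (⊨-old x y src-e (sym my))
        ... | no t∉m = proj₁ (fresh (lv G (tgt G e))) (⊨-fresh (tgt G e) t∉m (suc x) zero src-e refl)
        tgt≢ : tgt G e ≢ fV (mor m) x
        tgt≢ tgt-e with image? (fV (mor m)) (src G e)
        ... | yes (y , my) = proj₂ (old y) (⊨-old y x (sym my) tgt-e)
        ... | no s∉m = proj₂ (fresh (lv G (src G e))) (⊨-fresh (src G e) s∉m zero (suc x) refl tgt-e)

  -- Test colourings and pushouts

  mark : {X : Set} → Dec X → Fin 2
  mark (yes _) = zero
  mark (no _) = suc zero

  mark-yes : {X : Set} (x? : Dec X) → X → mark x? ≡ zero
  mark-yes (yes _) _ = refl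
  mark-yes (no ¬x) x = ⊥-elim (¬x x)

  mark≡0⇒ : {X : Set} (x? : Dec X) → mark x? ≡ zero → X
  mark≡0⇒ (yes x) _ = x

  -- The graph with a node for every label and colour in Fin 2, and an edge for every label,
  -- pair of nodes and bit in Fin 2. Any graph maps to it by colouring its nodes and edges.
  module Palette where

    nodes : ℕ
    nodes = k * 2

    node : Fin k → Fin 2 → Fin nodes
    node = combine

    edge : Fin k → Fin nodes → Fin nodes → Fin 2 → Fin (k * (nodes * (nodes * 2)))
    edge a s t b = combine a (combine s (combine t b))

    unedge : Fin (k * (nodes * (nodes * 2))) → Fin k × Fin nodes × Fin nodes
    unedge = map₂ (map₂ (proj₁ ∘ remQuot 2) ∘ remQuot (nodes * 2)) ∘ remQuot (nodes * (nodes * 2))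

    unedge-edge : ∀ a s t b → unedge (edge a s t b) ≡ (a , s , t)
    unedge-edge a s t b =
      trans (cong (map₂ (map₂ (proj₁ ∘ remQuot 2) ∘ remQuot (nodes * 2))) (remQuot-combine a _))
        (cong (a ,_) (trans (cong (map₂ (proj₁ ∘ remQuot 2)) (remQuot-combine s _))
          (cong (λ tb → s , proj₁ tb) (remQuot-combine t b))))

    palette : Gr
    palette = record
      { nV = nodes ; nE = k * (nodes * (nodes * 2))
      ; src = proj₁ ∘ proj₂ ∘ unedge ; tgt = proj₂ ∘ proj₂ ∘ unedge
      ; lv = proj₁ ∘ remQuot {k} 2 ; le = proj₁ ∘ unedge }

    colour : (X : Gr) → (Fin (nV X) → Fin 2) → (Fin (nE X) → Fin 2) → Mor X palette
    colour X col bit = record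
      { fV = colV ; fE = λ e → edge (le X e) (colV (src X e)) (colV (tgt X e)) (bit e)
      ; src-pres = λ e → cong (proj₁ ∘ proj₂) (unedge-edge _ _ _ _)
      ; tgt-pres = λ e → cong (proj₂ ∘ proj₂) (unedge-edge _ _ _ _)
      ; lv-pres = λ v → cong proj₁ (remQuot-combine (lv X v) (col v))
      ; le-pres = λ e → cong proj₁ (unedge-edge _ _ _ _) }
      where
        colV : Fin (nV X) → Fin nodes
        colV v = node (lv X v) (col v)

    node-colour-injective : ∀ {a c a′ c′} → node a c ≡ node a′ c′ → c ≡ c′
    node-colour-injective {a} {c} {a′} {c′} = combine-injectiveʳ a c a′ c′

    edge-bit-injective : ∀ {a s t b a′ s′ t′ b′} → edge a s t b ≡ edge a′ s′ t′ b′ → b ≡ b′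
    edge-bit-injective {a} {s} {t} {b} {a′} {s′} {t′} {b′} =
      combine-injectiveʳ t b t′ b′ ∘ combine-injectiveʳ s _ s′ _ ∘ combine-injectiveʳ a _ a′ _

    colour-∘ : {X Y : Gr} (φ : Mor Y X) (col : Fin (nV X) → Fin 2) (bit : Fin (nE X) → Fin 2)
      {col′ : Fin (nV Y) → Fin 2} {bit′ : Fin (nE Y) → Fin 2} →
      col ∘ fV φ ≗ col′ → bit ∘ fE φ ≗ bit′ → (colour X col bit ∘ₘ φ) ≈ₘ colour Y col′ bit′
    colour-∘ {X} {Y} φ col bit {col′} col≗ bit≗ = colV≗ , λ e →
      cong₂ (λ a (s , t , b) → edge a s t b) (le-pres φ e)
        (cong₂ _,_ (trans (cong colV (src-pres φ e)) (colV≗ _))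
          (cong₂ _,_ (trans (cong colV (tgt-pres φ e)) (colV≗ _)) (bit≗ e)))
      where
        colV : Fin (nV X) → Fin nodes
        colV v = node (lv X v) (col v)
        colV≗ : ∀ v → colV (fV φ v) ≡ node (lv Y v) (col′ v)
        colV≗ v = cong₂ node (lv-pres φ v) (col≗ v)

    colour-square : {A B C : Gr} (f : Mor A B) (g : Mor A C)
      (col₁ : Fin (nV B) → Fin 2) (bit₁ : Fin (nE B) → Fin 2) (col₂ : Fin (nV C) → Fin 2) (bit₂ : Fin (nE C) → Fin 2) →
      col₁ ∘ fV f ≗ col₂ ∘ fV g → bit₁ ∘ fE f ≗ bit₂ ∘ fE g →
      (colour B col₁ bit₁ ∘ₘ f) ≈ₘ (colour C col₂ bit₂ ∘ₘ g)
    colour-square {A} {B} {C} f g col₁ bit₁ col₂ bit₂ col≗ bit≗ =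
      (λ v → trans (proj₁ viaf v) (sym (proj₁ viag v))) , (λ e → trans (proj₂ viaf e) (sym (proj₂ viag e)))
      where
        viaf : (colour B col₁ bit₁ ∘ₘ f) ≈ₘ colour A (col₂ ∘ fV g) (bit₂ ∘ fE g)
        viaf = colour-∘ f col₁ bit₁ col≗ bit≗
        viag : (colour C col₂ bit₂ ∘ₘ g) ≈ₘ colour A (col₂ ∘ fV g) (bit₂ ∘ fE g)
        viag = colour-∘ g col₂ bit₂ (λ _ → refl) (λ _ → refl)

  module _ {A B C D : Gr} {f : Mor A B} {g : Mor A C} {i : Mor B D} {j : Mor C D}
           (po : IsPushout f g i j) where
    open Palette

    pushout-jointly-epic : ∀ {X} (u u′ : Mor D X) →
      (u ∘ₘ i) ≈ₘ (u′ ∘ₘ i) → (u ∘ₘ j) ≈ₘ (u′ ∘ₘ j) → u ≈ₘ u′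
    pushout-jointly-epic {X} u u′ (iV , iE) (jV , jE) =
      let (_ , _ , _ , unique) = proj₂ po X (u ∘ₘ i) (u ∘ₘ j)
                                   (cong (fV u) ∘ proj₁ (proj₁ po) , cong (fE u) ∘ proj₂ (proj₁ po))
          (uV , uE) = unique u ((λ _ → refl) , (λ _ → refl)) ((λ _ → refl) , (λ _ → refl))
          (u′V , u′E) = unique u′ (sym ∘ iV , sym ∘ iE) (sym ∘ jV , sym ∘ jE)
      in (λ v → trans (uV v) (sym (u′V v))) , (λ e → trans (uE e) (sym (u′E e)))

    private
      zeros : ∀ {n} → Fin n → Fin 2
      zeros _ = zero

    -- Colouring the edges outside the images of i and j with 1 does not change the
    -- composites with i and j of the all-0 colouring of D.
    pushout-jointly-surjective : ∀ e → Image (fE i) e ⊎ Image (fE j) e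
    pushout-jointly-surjective e = mark≡0⇒ (covered? e) (sym (edge-bit-injective (proj₂ plain≈marked e)))
      where
        covered? : ∀ e → Dec (Image (fE i) e ⊎ Image (fE j) e)
        covered? e = image? (fE i) e ⊎-dec image? (fE j) e
        plain≈marked : colour D zeros zeros ≈ₘ colour D zeros (mark ∘ covered?)
        plain≈marked = pushout-jointly-epic (colour D zeros zeros) (colour D zeros (mark ∘ covered?))
          (colour-square i i zeros zeros zeros (mark ∘ covered?) (λ _ → refl) (λ e → sym (mark-yes (covered? _) (inj₁ (e , refl)))))
          (colour-square j j zeros zeros zeros (mark ∘ covered?) (λ _ → refl) (λ e → sym (mark-yes (covered? _) (inj₂ (e , refl)))))

    -- Colour the nodes of B outside the image of f with 1 and everything else with 0.
    pushout-shared-node : ∀ {x v} → fV i x ≡ fV j v → Image (fV f) x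
    pushout-shared-node {x} {v} ix≡jv =
      let (u , (u∘iV , _) , (u∘jV , _) , _) = proj₂ po palette (colour B (mark ∘ in-f?) zeros) (colour C zeros zeros) square
      in mark≡0⇒ (in-f? x) (node-colour-injective (trans (sym (u∘iV x)) (trans (cong (fV u) ix≡jv) (u∘jV v))))
      where
        in-f? : ∀ x → Dec (Image (fV f) x)
        in-f? = image? (fV f)
        square : (colour B (mark ∘ in-f?) zeros ∘ₘ f) ≈ₘ (colour C zeros zeros ∘ₘ g)
        square = colour-square f g (mark ∘ in-f?) zeros zeros zeros (λ a → mark-yes (in-f? _) (a , refl)) (λ _ → refl)

  pushout⇒dangling : {K L D G : Gr} (l : Inj K L) (m : Inj L G) {k′ : Mor K D} {d : Mor D G} →
    IsPushout (mor l) k′ (mor m) d → Dangling l m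
  pushout⇒dangling {G = G} l m {k′} {d} po e e∉m x x∉l with pushout-jointly-surjective {f = mor l} {k′} {mor m} {d} po e
  ... | inj₁ e∈m = ⊥-elim (e∉m e∈m)
  ... | inj₂ (e₁ , refl) =
    (λ src≡ → x∉l (shared (trans (sym src≡) (src-pres d e₁)))) , (λ tgt≡ → x∉l (shared (trans (sym tgt≡) (tgt-pres d e₁))))
    where
      shared : ∀ {v} → fV (mor m) x ≡ fV d v → Image (fV (mor l)) x
      shared = pushout-shared-node {f = mor l} {k′} {mor m} {d} po

  record JointlySurjective {B C D : Gr} (i : Mor B D) (j : Mor C D) : Set where
    field
      onNodes : ∀ v → Image (fV i) v ⊎ Image (fV j) v
      onEdges : ∀ e → Image (fE i) e ⊎ Image (fE j) e

  record Mediates {B C D X : Gr} (i : Mor B D) (j : Mor C D) (i′ : Mor B X) (j′ : Mor C X)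
                  (uV : Fin (nV D) → Fin (nV X)) (uE : Fin (nE D) → Fin (nE X)) : Set where
    field
      uV∘i : uV ∘ fV i ≗ fV i′
      uE∘i : uE ∘ fE i ≗ fE i′
      uV∘j : uV ∘ fV j ≗ fV j′
      uE∘j : uE ∘ fE j ≗ fE j′

  module _ {B C D : Gr} {i : Mor B D} {j : Mor C D} (surj : JointlySurjective i j) where
    open JointlySurjective surj

    jointlySurjective-unique : ∀ {X} (u u′ : Mor D X) →
      (u ∘ₘ i) ≈ₘ (u′ ∘ₘ i) → (u ∘ₘ j) ≈ₘ (u′ ∘ₘ j) → u ≈ₘ u′
    jointlySurjective-unique u u′ (uiV , uiE) (ujV , ujE) = onV , onE
      where
        onV : ∀ v → fV u v ≡ fV u′ v
        onV v with onNodes v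
        ... | inj₁ (x , refl) = uiV x
        ... | inj₂ (x , refl) = ujV x
        onE : ∀ e → fE u e ≡ fE u′ e
        onE e with onEdges e
        ... | inj₁ (x , refl) = uiE x
        ... | inj₂ (x , refl) = ujE x

    mediates-isMorphism : ∀ {X} {i′ : Mor B X} {j′ : Mor C X} {uV uE} → Mediates i j i′ j′ uV uE → IsMorphism D X uV uE
    mediates-isMorphism {X} {i′} {j′} {uV} {uE} med = src-pres′ , tgt-pres′ , lv-pres′ , le-pres′
      where
        open Mediates med
        src-pres′ : ∀ e → src X (uE e) ≡ uV (src D e)
        src-pres′ e with onEdges e
        ... | inj₁ (x , refl) =
          trans (cong (src X) (uE∘i x)) (trans (src-pres i′ x) (trans (sym (uV∘i _)) (cong uV (sym (src-pres i x)))))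
        ... | inj₂ (x , refl) =
          trans (cong (src X) (uE∘j x)) (trans (src-pres j′ x) (trans (sym (uV∘j _)) (cong uV (sym (src-pres j x)))))
        tgt-pres′ : ∀ e → tgt X (uE e) ≡ uV (tgt D e)
        tgt-pres′ e with onEdges e
        ... | inj₁ (x , refl) =
          trans (cong (tgt X) (uE∘i x)) (trans (tgt-pres i′ x) (trans (sym (uV∘i _)) (cong uV (sym (tgt-pres i x)))))
        ... | inj₂ (x , refl) =
          trans (cong (tgt X) (uE∘j x)) (trans (tgt-pres j′ x) (trans (sym (uV∘j _)) (cong uV (sym (tgt-pres j x)))))
        lv-pres′ : ∀ v → lv X (uV v) ≡ lv D v
        lv-pres′ v with onNodes v
        ... | inj₁ (x , refl) = trans (cong (lv X) (uV∘i x)) (trans (lv-pres i′ x) (sym (lv-pres i x)))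
        ... | inj₂ (x , refl) = trans (cong (lv X) (uV∘j x)) (trans (lv-pres j′ x) (sym (lv-pres j x)))
        le-pres′ : ∀ e → le X (uE e) ≡ le D e
        le-pres′ e with onEdges e
        ... | inj₁ (x , refl) = trans (cong (le X) (uE∘i x)) (trans (le-pres i′ x) (sym (le-pres i x)))
        ... | inj₂ (x , refl) = trans (cong (le X) (uE∘j x)) (trans (le-pres j′ x) (sym (le-pres j x)))

  pushout-criterion : {A B C D : Gr} {f : Mor A B} {g : Mor A C} {i : Mor B D} {j : Mor C D} →
    (i ∘ₘ f) ≈ₘ (j ∘ₘ g) → (surj : JointlySurjective i j) →
    (∀ {X} (i′ : Mor B X) (j′ : Mor C X) → (i′ ∘ₘ f) ≈ₘ (j′ ∘ₘ g) → ∃₂ (Mediates i j i′ j′)) →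
    IsPushout f g i j
  pushout-criterion square surj mediate = square , λ X i′ j′ commutes →
    let (uV , uE , med) = mediate i′ j′ commutes
        u = toMor (mediates-isMorphism surj med)
        open Mediates med
    in u , (uV∘i , uE∘i) , (uV∘j , uE∘j) , λ u′ (u′iV , u′iE) (u′jV , u′jE) →
         jointlySurjective-unique surj u′ u
           ((λ x → trans (u′iV x) (sym (uV∘i x))) , (λ x → trans (u′iE x) (sym (uE∘i x))))
           ((λ x → trans (u′jV x) (sym (uV∘j x))) , (λ x → trans (u′jE x) (sym (uE∘j x))))

  -- The double pushout at a match satisfying the dangling condition

  module DoublePushout {K L R G : Gr} (l : Inj K L) (r : Inj K R) (m : Inj L G) (dangling : Dangling l m) where

    open ≡-Reasoning

    mV : Fin (nV L) → Fin (nV G)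
    mV = fV (mor m)

    mE : Fin (nE L) → Fin (nE G)
    mE = fE (mor m)

    KeptV : Fin (nV G) → Set
    KeptV w = ¬ (∃ λ x → mV x ≡ w × ¬ Image (fV (mor l)) x)

    KeptE : Fin (nE G) → Set
    KeptE e = ¬ (∃ λ x → mE x ≡ e × ¬ Image (fE (mor l)) x)

    module DV = Enumeration (enumerate {P = KeptV} λ w → ¬? (any? λ x → (mV x ≟ w) ×-dec ¬? (image? (fV (mor l)) x)))
    module DE = Enumeration (enumerate {P = KeptE} λ e → ¬? (any? λ x → (mE x ≟ e) ×-dec ¬? (image? (fE (mor l)) x)))

    keptV-preserved : ∀ {x} → KeptV (mV x) → Image (fV (mor l)) x
    keptV-preserved kept = decidable-stable (image? _ _) λ x∉l → kept (_ , refl , x∉l)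

    keptE-preserved : ∀ {x} → KeptE (mE x) → Image (fE (mor l)) x
    keptE-preserved kept = decidable-stable (image? _ _) λ x∉l → kept (_ , refl , x∉l)

    preservedV-kept : ∀ {x} → Image (fV (mor l)) x → KeptV (mV x)
    preservedV-kept x∈l (_ , eq , x′∉l) = x′∉l (subst (Image (fV (mor l))) (sym (proj₁ (isInj m) eq)) x∈l)

    preservedE-kept : ∀ {x} → Image (fE (mor l)) x → KeptE (mE x)
    preservedE-kept x∈l (_ , eq , x′∉l) = x′∉l (subst (Image (fE (mor l))) (sym (proj₂ (isInj m) eq)) x∈l)

    -- Endpoints of kept edges are kept: for edges outside the match this is the dangling condition.
    kept-src : ∀ i → KeptV (src G (DE.embed i))
    kept-src i (x , mx≡ , x∉l) with image? mE (DE.embed i)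
    ... | no e∉m = proj₁ (dangling _ e∉m x x∉l) (sym mx≡)
    ... | yes (x′ , mx′≡) with keptE-preserved (subst KeptE (sym mx′≡) (DE.embed-∈ i))
    ...   | y , ly≡x′ = x∉l (src K y , proj₁ (isInj m) (begin
            mV (fV (mor l) (src K y))    ≡⟨ cong mV (src-pres (mor l) y) ⟨
            mV (src L (fE (mor l) y))    ≡⟨ cong (mV ∘ src L) ly≡x′ ⟩
            mV (src L x′)                ≡⟨ src-pres (mor m) x′ ⟨
            src G (mE x′)                ≡⟨ cong (src G) mx′≡ ⟩
            src G (DE.embed i)           ≡⟨ mx≡ ⟨
            mV x                          ∎))

    kept-tgt : ∀ i → KeptV (tgt G (DE.embed i))
    kept-tgt i (x , mx≡ , x∉l) with image? mE (DE.embed i)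
    ... | no e∉m = proj₂ (dangling _ e∉m x x∉l) (sym mx≡)
    ... | yes (x′ , mx′≡) with keptE-preserved (subst KeptE (sym mx′≡) (DE.embed-∈ i))
    ...   | y , ly≡x′ = x∉l (tgt K y , proj₁ (isInj m) (begin
            mV (fV (mor l) (tgt K y))    ≡⟨ cong mV (tgt-pres (mor l) y) ⟨
            mV (tgt L (fE (mor l) y))    ≡⟨ cong (mV ∘ tgt L) ly≡x′ ⟩
            mV (tgt L x′)                ≡⟨ tgt-pres (mor m) x′ ⟨
            tgt G (mE x′)                ≡⟨ cong (tgt G) mx′≡ ⟩
            tgt G (DE.embed i)           ≡⟨ mx≡ ⟨
            mV x                          ∎))

    D : Gr
    D = record
      { nV = DV.size ; nE = DE.size
      ; src = λ i → DV.index _ (kept-src i) ; tgt = λ i → DV.index _ (kept-tgt i)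
      ; lv = lv G ∘ DV.embed ; le = le G ∘ DE.embed }

    d : Mor D G
    d = record
      { fV = DV.embed ; fE = DE.embed
      ; src-pres = λ _ → sym (DV.embed-index _ _) ; tgt-pres = λ _ → sym (DV.embed-index _ _)
      ; lv-pres = λ _ → refl ; le-pres = λ _ → refl }

    k′ : Mor K D
    k′ = record
      { fV = λ y → DV.index _ (preservedV-kept (y , refl)) ; fE = λ y → DE.index _ (preservedE-kept (y , refl))
      ; src-pres = λ y → DV.index-cong _ _
          (trans (cong (src G) (DE.embed-index _ _)) (trans (src-pres (mor m) _) (cong mV (src-pres (mor l) y))))
      ; tgt-pres = λ y → DV.index-cong _ _
          (trans (cong (tgt G) (DE.embed-index _ _)) (trans (tgt-pres (mor m) _) (cong mV (tgt-pres (mor l) y))))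
      ; lv-pres = λ y → trans (cong (lv G) (DV.embed-index _ _)) (trans (lv-pres (mor m) _) (lv-pres (mor l) y))
      ; le-pres = λ y → trans (cong (le G) (DE.embed-index _ _)) (trans (le-pres (mor m) _) (le-pres (mor l) y)) }

    d∘k′ : (mor m ∘ₘ mor l) ≈ₘ (d ∘ₘ k′)
    d∘k′ = (λ _ → sym (DV.embed-index _ _)) , (λ _ → sym (DE.embed-index _ _))

    m,d-surjective : JointlySurjective (mor m) d
    m,d-surjective = record { onNodes = onV ; onEdges = onE }
      where
        onV : ∀ w → Image mV w ⊎ Image DV.embed w
        onV w with image? mV w
        ... | yes w∈m = inj₁ w∈m
        ... | no w∉m = inj₂ (_ , DV.embed-index w λ (x , mx≡w , _) → w∉m (x , mx≡w))
        onE : ∀ e → Image mE e ⊎ Image DE.embed e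
        onE e with image? mE e
        ... | yes e∈m = inj₁ e∈m
        ... | no e∉m = inj₂ (_ , DE.embed-index e λ (x , mx≡e , _) → e∉m (x , mx≡e))

    pushout₁ : IsPushout (mor l) k′ (mor m) d
    pushout₁ = pushout-criterion {f = mor l} {g = k′} d∘k′ m,d-surjective mediate
      where
        mediate : ∀ {X} (i′ : Mor L X) (j′ : Mor D X) → (i′ ∘ₘ mor l) ≈ₘ (j′ ∘ₘ k′) →
          ∃₂ (Mediates (mor m) d i′ j′)
        mediate {X} i′ j′ (comV , comE) = uV , uE , record { uV∘i = uV∘m ; uE∘i = uE∘m ; uV∘j = uV∘d ; uE∘j = uE∘d }
          where
            uV : Fin (nV G) → Fin (nV X)
            uV w with image? mV w
            ... | yes (x , _) = fV i′ x
            ... | no w∉m = fV j′ (DV.index w λ (x , mx≡w , _) → w∉m (x , mx≡w))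
            uE : Fin (nE G) → Fin (nE X)
            uE e with image? mE e
            ... | yes (x , _) = fE i′ x
            ... | no e∉m = fE j′ (DE.index e λ (x , mx≡e , _) → e∉m (x , mx≡e))

            uV∘m : ∀ x → uV (mV x) ≡ fV i′ x
            uV∘m x with image? mV (mV x)
            ... | yes (x′ , eq) = cong (fV i′) (proj₁ (isInj m) eq)
            ... | no w∉m = ⊥-elim (w∉m (x , refl))
            uE∘m : ∀ x → uE (mE x) ≡ fE i′ x
            uE∘m x with image? mE (mE x)
            ... | yes (x′ , eq) = cong (fE i′) (proj₂ (isInj m) eq)
            ... | no e∉m = ⊥-elim (e∉m (x , refl))

            -- A kept item in the match comes from K, where i′ and j′ agree.
            uV∘d : ∀ z → uV (DV.embed z) ≡ fV j′ z
            uV∘d z with image? mV (DV.embed z)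
            ... | no _ = cong (fV j′) (DV.index-embed z _)
            ... | yes (x , mx≡) with keptV-preserved (subst KeptV (sym mx≡) (DV.embed-∈ z))
            ...   | y , refl = trans (comV y) (cong (fV j′) (DV.embed-injective (trans (DV.embed-index _ _) mx≡)))
            uE∘d : ∀ z → uE (DE.embed z) ≡ fE j′ z
            uE∘d z with image? mE (DE.embed z)
            ... | no _ = cong (fE j′) (DE.index-embed z _)
            ... | yes (x , mx≡) with keptE-preserved (subst KeptE (sym mx≡) (DE.embed-∈ z))
            ...   | y , refl = trans (comE y) (cong (fE j′) (DE.embed-injective (trans (DE.embed-index _ _) mx≡)))

    rV : Fin (nV K) → Fin (nV R)
    rV = fV (mor r)

    rE : Fin (nE K) → Fin (nE R)
    rE = fE (mor r)

    module NV = Enumeration (enumerate {P = λ y → ¬ Image rV y} λ y → ¬? (image? rV y))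
    module NE = Enumeration (enumerate {P = λ e → ¬ Image rE e} λ e → ¬? (image? rE e))

    -- H consists of D followed by fresh copies of the items of R outside r(K).
    comatchV : Fin (nV R) → Fin (DV.size + NV.size)
    comatchV y with image? rV y
    ... | yes (z , _) = fV k′ z ↑ˡ NV.size
    ... | no y∉r = DV.size ↑ʳ NV.index y y∉r

    comatchE : Fin (nE R) → Fin (DE.size + NE.size)
    comatchE e with image? rE e
    ... | yes (z , _) = fE k′ z ↑ˡ NE.size
    ... | no e∉r = DE.size ↑ʳ NE.index e e∉r

    comatchV∘r : ∀ z → comatchV (rV z) ≡ fV k′ z ↑ˡ NV.size
    comatchV∘r z with image? rV (rV z)
    ... | yes (z′ , eq) = cong (λ z → fV k′ z ↑ˡ NV.size) (proj₁ (isInj r) eq)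
    ... | no y∉r = ⊥-elim (y∉r (z , refl))

    comatchE∘r : ∀ z → comatchE (rE z) ≡ fE k′ z ↑ˡ NE.size
    comatchE∘r z with image? rE (rE z)
    ... | yes (z′ , eq) = cong (λ z → fE k′ z ↑ˡ NE.size) (proj₂ (isInj r) eq)
    ... | no e∉r = ⊥-elim (e∉r (z , refl))

    comatchV-new : ∀ i → comatchV (NV.embed i) ≡ DV.size ↑ʳ i
    comatchV-new i with image? rV (NV.embed i)
    ... | yes y∈r = ⊥-elim (NV.embed-∈ i y∈r)
    ... | no y∉r = cong (DV.size ↑ʳ_) (NV.index-embed i y∉r)

    comatchE-new : ∀ i → comatchE (NE.embed i) ≡ DE.size ↑ʳ i
    comatchE-new i with image? rE (NE.embed i)
    ... | yes e∈r = ⊥-elim (NE.embed-∈ i e∈r)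
    ... | no e∉r = cong (DE.size ↑ʳ_) (NE.index-embed i e∉r)

    srcD↑ tgtD↑ : Fin DE.size → Fin (DV.size + NV.size)
    srcD↑ i = src D i ↑ˡ NV.size
    tgtD↑ i = tgt D i ↑ˡ NV.size

    H : Gr
    H = record
      { nV = DV.size + NV.size ; nE = DE.size + NE.size
      ; src = [ srcD↑ , comatchV ∘ src R ∘ NE.embed ]ᶠ
      ; tgt = [ tgtD↑ , comatchV ∘ tgt R ∘ NE.embed ]ᶠ
      ; lv = [ lv D , lv R ∘ NV.embed ]ᶠ
      ; le = [ le D , le R ∘ NE.embed ]ᶠ }

    h : Mor D H
    h = record
      { fV = _↑ˡ NV.size ; fE = _↑ˡ NE.size
      ; src-pres = [,]ᶠ-↑ˡ _ _ ; tgt-pres = [,]ᶠ-↑ˡ _ _ ; lv-pres = [,]ᶠ-↑ˡ _ _ ; le-pres = [,]ᶠ-↑ˡ _ _ }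

    comatch : Mor R H
    comatch = record
      { fV = comatchV ; fE = comatchE
      ; src-pres = src-pres′ ; tgt-pres = tgt-pres′ ; lv-pres = lv-pres′ ; le-pres = le-pres′ }
      where
        src-pres′ : ∀ e → src H (comatchE e) ≡ comatchV (src R e)
        src-pres′ e with image? rE e
        ... | yes (z , refl) =
          trans ([,]ᶠ-↑ˡ srcD↑ (comatchV ∘ src R ∘ NE.embed) _) (trans (cong (_↑ˡ NV.size) (src-pres k′ z))
            (trans (sym (comatchV∘r _)) (cong comatchV (sym (src-pres (mor r) z)))))
        ... | no e∉r =
          trans ([,]ᶠ-↑ʳ {DE.size} srcD↑ (comatchV ∘ src R ∘ NE.embed) _) (cong (comatchV ∘ src R) (NE.embed-index e e∉r))
        tgt-pres′ : ∀ e → tgt H (comatchE e) ≡ comatchV (tgt R e)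
        tgt-pres′ e with image? rE e
        ... | yes (z , refl) =
          trans ([,]ᶠ-↑ˡ tgtD↑ (comatchV ∘ tgt R ∘ NE.embed) _) (trans (cong (_↑ˡ NV.size) (tgt-pres k′ z))
            (trans (sym (comatchV∘r _)) (cong comatchV (sym (tgt-pres (mor r) z)))))
        ... | no e∉r =
          trans ([,]ᶠ-↑ʳ {DE.size} tgtD↑ (comatchV ∘ tgt R ∘ NE.embed) _) (cong (comatchV ∘ tgt R) (NE.embed-index e e∉r))
        lv-pres′ : ∀ y → lv H (comatchV y) ≡ lv R y
        lv-pres′ y with image? rV y
        ... | yes (z , refl) = trans ([,]ᶠ-↑ˡ (lv D) (lv R ∘ NV.embed) _) (trans (lv-pres k′ z) (sym (lv-pres (mor r) z)))
        ... | no y∉r = trans ([,]ᶠ-↑ʳ {DV.size} (lv D) (lv R ∘ NV.embed) _) (cong (lv R) (NV.embed-index y y∉r))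
        le-pres′ : ∀ e → le H (comatchE e) ≡ le R e
        le-pres′ e with image? rE e
        ... | yes (z , refl) = trans ([,]ᶠ-↑ˡ (le D) (le R ∘ NE.embed) _) (trans (le-pres k′ z) (sym (le-pres (mor r) z)))
        ... | no e∉r = trans ([,]ᶠ-↑ʳ {DE.size} (le D) (le R ∘ NE.embed) _) (cong (le R) (NE.embed-index e e∉r))

    comatch,h-surjective : JointlySurjective comatch h
    comatch,h-surjective = record { onNodes = onV ; onEdges = onE }
      where
        onV : ∀ w → Image comatchV w ⊎ Image (_↑ˡ NV.size) w
        onV w with splitView DV.size NV.size w
        ... | left i = inj₂ (i , refl)
        ... | right i = inj₁ (NV.embed i , comatchV-new i)
        onE : ∀ e → Image comatchE e ⊎ Image (_↑ˡ NE.size) e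
        onE e with splitView DE.size NE.size e
        ... | left i = inj₂ (i , refl)
        ... | right i = inj₁ (NE.embed i , comatchE-new i)

    pushout₂ : IsPushout (mor r) k′ comatch h
    pushout₂ = pushout-criterion {f = mor r} {g = k′} ((λ z → comatchV∘r z) , (λ z → comatchE∘r z)) comatch,h-surjective mediate
      where
        mediate : ∀ {X} (i′ : Mor R X) (j′ : Mor D X) → (i′ ∘ₘ mor r) ≈ₘ (j′ ∘ₘ k′) →
          ∃₂ (Mediates comatch h i′ j′)
        mediate {X} i′ j′ (comV , comE) = uV , uE , record
          { uV∘i = uV∘comatch ; uE∘i = uE∘comatch
          ; uV∘j = [,]ᶠ-↑ˡ (fV j′) (fV i′ ∘ NV.embed) ; uE∘j = [,]ᶠ-↑ˡ (fE j′) (fE i′ ∘ NE.embed) }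
          where
            uV : Fin (DV.size + NV.size) → Fin (nV X)
            uV = [ fV j′ , fV i′ ∘ NV.embed ]ᶠ
            uE : Fin (DE.size + NE.size) → Fin (nE X)
            uE = [ fE j′ , fE i′ ∘ NE.embed ]ᶠ
            uV∘comatch : ∀ y → uV (comatchV y) ≡ fV i′ y
            uV∘comatch y with image? rV y
            ... | yes (z , refl) = trans ([,]ᶠ-↑ˡ (fV j′) (fV i′ ∘ NV.embed) _) (sym (comV z))
            ... | no y∉r = trans ([,]ᶠ-↑ʳ {DV.size} (fV j′) (fV i′ ∘ NV.embed) _) (cong (fV i′) (NV.embed-index y y∉r))
            uE∘comatch : ∀ e → uE (comatchE e) ≡ fE i′ e
            uE∘comatch e with image? rE e
            ... | yes (z , refl) = trans ([,]ᶠ-↑ˡ (fE j′) (fE i′ ∘ NE.embed) _) (sym (comE z))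
            ... | no e∉r = trans ([,]ᶠ-↑ʳ {DE.size} (fE j′) (fE i′ ∘ NE.embed) _) (cong (fE i′) (NE.embed-index e e∉r))

  applicationCond : (ρ : Rule (Fin k)) → Cond (L (prule ρ))
  applicationCond ρ = and (ac ρ) (danglingCond (l (prule ρ)))

  applicable⇔ : (ρ : Rule (Fin k)) (G : Gr) → Applicable ρ G ⇔ Σ (Inj (L (prule ρ)) G) (_⊨ applicationCond ρ)
  applicable⇔ ρ G = mk⇔
    (λ (_ , m , s , _ , k′ , d , _ , _ , pushout₁ , _) →
      m , s , dangling⇒⊨danglingCond (l (prule ρ)) m (pushout⇒dangling (l (prule ρ)) m {k′} {d} pushout₁))
    (λ (m , s , s-dangling) →
      let open DoublePushout (l (prule ρ)) (r (prule ρ)) m (⊨danglingCond⇒dangling (l (prule ρ)) m s-dangling)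
      in H , m , s , D , k′ , d , h , comatch , pushout₁ , pushout₂)

  someApplicable : {P : Gr} → GTS (Fin k) → Cond P
  someApplicable [] = false
  someApplicable (ρ ∷ ℛ) = or (occurs (L (prule ρ)) (applicationCond ρ)) (someApplicable ℛ)

  ⊨-someApplicable : {P G : Gr} (ℛ : GTS (Fin k)) (g : Inj P G) →
    g ⊨ someApplicable ℛ ⇔ (∃ λ ρ → ρ ∈ ℛ × Applicable ρ G)
  ⊨-someApplicable [] g = mk⇔ (λ s → ⊥-elim (s tt)) λ ()
  ⊨-someApplicable {G = G} (ρ ∷ ℛ) g = mk⇔ to from
    where
      ⊨-head : g ⊨ occurs (L (prule ρ)) (applicationCond ρ) ⇔ Applicable ρ G
      ⊨-head = mk⇔ (Equivalence.from (applicable⇔ ρ G) ∘ Equivalence.to (⊨-occurs (L (prule ρ)) (applicationCond ρ) g))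
                   (Equivalence.from (⊨-occurs (L (prule ρ)) (applicationCond ρ) g) ∘ Equivalence.to (applicable⇔ ρ G))
      to : g ⊨ someApplicable (ρ ∷ ℛ) → ∃ λ ρ′ → ρ′ ∈ ρ ∷ ℛ × Applicable ρ′ G
      to s with Equivalence.to (⊨-or g _ _) s
      ... | inj₁ s-head = ρ , here refl , Equivalence.to ⊨-head s-head
      ... | inj₂ s-tail with Equivalence.to (⊨-someApplicable ℛ g) s-tail
      ...   | ρ′ , ρ′∈ℛ , applicable = ρ′ , there ρ′∈ℛ , applicable
      from : (∃ λ ρ′ → ρ′ ∈ ρ ∷ ℛ × Applicable ρ′ G) → g ⊨ someApplicable (ρ ∷ ℛ)
      from (_ , here refl , applicable) = Equivalence.from (⊨-or g _ _) (inj₁ (Equivalence.from ⊨-head applicable))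
      from (ρ′ , there ρ′∈ℛ , applicable) =
        Equivalence.from (⊨-or g _ _) (inj₂ (Equivalence.from (⊨-someApplicable ℛ g) (ρ′ , ρ′∈ℛ , applicable)))

mainTheorem3 : (k : ℕ) (ℛ : GTS (Fin k)) (p : PlainRule (Fin k)) →
    Σ[ app ∈ Cond (L p) ]
      ((∀ (G H' : Graph (Fin k)) (g : Inj (L p) G) → DirectTransf (asRule p) G H' g →
          ((g ⊨ app) ⇔ (∃[ H ] (G ⇒ₛ[ ℛ ] H))))
       ×
       (∀ (G : Graph (Fin k)) → Applicable ⟨ p , not app ⟩ G →
          ∀ (ρ : Rule (Fin k)) → ρ ∈ ℛ → ¬ Applicable ρ G))
mainTheorem3 k ℛ p = someApplicable ℛ , app-characterises , app-excludes
  where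
    app-characterises : ∀ G H′ (g : Inj (L p) G) → DirectTransf (asRule p) G H′ g →
      g ⊨ someApplicable ℛ ⇔ (∃[ H ] (G ⇒ₛ[ ℛ ] H))
    app-characterises G _ g _ = mk⇔
      (λ s → let (ρ , ρ∈ℛ , H , t) = Equivalence.to (⊨-someApplicable ℛ g) s in H , ρ , ρ∈ℛ , t)
      (λ (H , ρ , ρ∈ℛ , t) → Equivalence.from (⊨-someApplicable ℛ g) (ρ , ρ∈ℛ , H , t))

    app-excludes : ∀ G → Applicable ⟨ p , not (someApplicable ℛ) ⟩ G → ∀ ρ → ρ ∈ ℛ → ¬ Applicable ρ G
    app-excludes G (_ , g , ¬s , _) ρ ρ∈ℛ applicable =
      ¬s (Equivalence.from (⊨-someApplicable ℛ g) (ρ , ρ∈ℛ , applicable))
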